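{- Let $G$ be any graph and let $\mathfrak v=(\mathcal F_X)_{X\in\mathcal X}\in\mathfrak F\setminus\Omega$. Then the set $\mathcal X_{\mathfrak v}=\{X\in\mathcal X:\mathcal F_X\text{ is not of the form }c_X(C)\}$ has a least element $X_{\mathfrak v}$, which is critical, and $\mathcal X_{\mathfrak v}$ consists exactly of the finite supersets of $X_{\mathfrak v}$; the set $X_{\mathfrak v}$ determines $\mathfrak v$, and $\mathcal F_X=\mathcal F_X(X_{\mathfrak v})$ for every $X\in\mathcal X_{\mathfrak v}$. Furthermore, for every critical $Y\in\mathcal X$ there is a unique $\mathfrak v\in\mathfrak F$ with $X_{\mathfrak v}=Y$. Thus $\mathfrak v\mapsto X_{\mathfrak v}$ is a bijection between $\mathfrak F\setminus\Omega$ and the set of critical elements of $\mathcal X$.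
   Context: Let $\mathcal X$ be the set of finite subsets of $V(G)$, $\mathcal C_X$ the set of components of $G-X$ (with the discrete topology), and for $X\subseteq X'$ let $\phi_{X',X}$ send a component of $G-X'$ to the component of $G-X$ containing it. For $Y\subseteq X$ let $\mathcal C_X(Y)$ be the set of components of $G-X$ whose neighbourhood is exactly $Y$, and $\mathrm{crit}(X)=\{Y\subseteq X:\mathcal C_X(Y)\text{ infinite}\}$. $X\in\mathcal X$ is critical if $X\in\mathrm{crit}(X)$. For $C\in\mathcal C_X$ let $c_X(C)$ be the principal ultrafilter on $\mathcal C_X$ generated by $\{C\}$. For $Y\in\mathrm{crit}(X)$ let $\mathcal F_X(Y)$ be the set of all $\mathcal C\subseteq\mathcal C_X$ containing a cofinite subset of $\mathcal C_X(Y)$. Let $\mathfrak F_X=\{c_X(C):C\in\mathcal C_X\}\cup\{\mathcal F_X(Y):Y\in\mathrm{crit}(X)\}$ with the topology generated by the sets $\{\mathcal F\in\mathfrak F_X:\mathcal C\in\mathcal F\}$, $\mathcal C\subseteq\mathcal C_X$. For $X\subseteq X'$ define $\mathfrak f_{X',X}:\mathfrak F_{X'}\to\mathfrak F_X$ by $\mathfrak f_{X',X}(c_{X'}(C'))=c_X(\phi_{X',X}(C'))$; $\mathfrak f_{X',X}(\mathcal F_{X'}(Y))=\mathcal F_X(Y)$ if $Y\subseteq X$; and $\mathfrak f_{X',X}(\mathcal F_{X'}(Y))=c_X(C)$ if $Y\not\subseteq X$, where $C$ is the unique component of $G-X$ including $\bigcup\mathcal C_{X'}(Y)$. $\mathfrak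 F$ is the inverse limit, i.e. the set of families $(\mathcal F_X)_{X\in\mathcal X}$ with $\mathcal F_X\in\mathfrak F_X$ and $\mathfrak f_{X',X}(\mathcal F_{X'})=\mathcal F_X$ for $X\subseteq X'$. The ends of $G$ are identified with the elements of $\mathfrak F$ of the form $(c_X(C(X,\omega)))_X$, where $\omega$ is an end and $C(X,\omega)$ is the component of $G-X$ containing a tail of every ray in $\omega$; $\Omega$ denotes this subset of $\mathfrak F$ (exactly the elements all of whose coordinates are of the form $c_X(C)$). -}

module Defs where

open import Level using (Level; Setω)
open import Data.List using (List)
open import Data.List.Membership.Propositional using (_∈_; _∉_)
open import Data.List.Relation.Unary.Any using (Any)
open import Data.Product using (Σ; _×_; _,_; proj₁; proj₂)
open import Data.Sum using (_⊎_)
open import Relation.Nullary using (¬_)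

_↔_ : ∀ {a b : Level} → Set a → Set b → Set _
A ↔ B = (A → B) × (B → A)

LEM : Setω
LEM = ∀ {ℓ : Level} (P : Set ℓ) → P ⊎ ¬ P

record Graph : Set₁ where
  field
    V : Set
    _~_ : V → V → Set
    ~-sym : ∀ {u v} → u ~ v → v ~ u
    ~-irrefl : ∀ {v} → ¬ (v ~ v)

module _ (G : Graph) where
  open Graph G

  -- elements of 𝒳: finite subsets of V(G), given by lists (as sets: via ∈)
  FinSet : Set
  FinSet = List V

  _⊆_ : FinSet → FinSet → Set
  X ⊆ Y = ∀ {v} → v ∈ X → v ∈ Y

  data Conn (X : FinSet) : V → V → Set where
    here : ∀ {v} → v ∉ X → Conn X v v
    step : ∀ {u w v} → u ∉ X → u ~ w → Conn X w v → Conn X u v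

  -- a component of G - X, given by a representative vertex;
  -- its vertex set is { v | Conn X rep v }
  record Comp (X : FinSet) : Set where
    constructor comp
    field
      rep : V
      rep∉ : rep ∉ X

  open Comp public

  _∈C_ : ∀ {X} → V → Comp X → Set
  _∈C_ {X} v C = Conn X (rep C) v

  -- equality of components (same vertex set)
  _≈C_ : ∀ {X} → Comp X → Comp X → Set
  _≈C_ {X} C D = Conn X (rep C) (rep D)

  InNbhd : ∀ {X} → Comp X → V → Set
  InNbhd C x = ¬ (x ∈C C) × Σ V (λ v → (v ∈C C) × (v ~ x))

  𝒞 : (X Y : FinSet) → Comp X → Set
  𝒞 X Y C = ∀ x → InNbhd C x ↔ (x ∈ Y)

  FiniteComps : (X : FinSet) → (Comp X → Set) → Set
  FiniteComps X P = Σ (List (Comp X)) λ L → ∀ C → P C → Any (C ≈C_) L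

  InfiniteComps : (X : FinSet) → (Comp X → Set) → Set
  InfiniteComps X P = ¬ FiniteComps X P

  Crit : (X Y : FinSet) → Set
  Crit X Y = (Y ⊆ X) × InfiniteComps X (𝒞 X Y)

  Critical : FinSet → Set
  Critical X = Crit X X

  SubComp : FinSet → Set₁
  SubComp X = Σ (Comp X → Set) λ P → ∀ {C D} → C ≈C D → P C → P D

  Filt : FinSet → Set₁
  Filt X = SubComp X → Set

  _≐_ : ∀ {X} → Filt X → Filt X → Set₁
  _≐_ {X} F H = ∀ (𝒞′ : SubComp X) → F 𝒞′ ↔ H 𝒞′

  cX : (X : FinSet) → Comp X → Filt X
  cX X C 𝒞′ = proj₁ 𝒞′ C

  -- ℱ_X(Y): sets of components containing a cofinite subset of 𝒞_X(Y)
  ℱX : (X Y : FinSet) → Filt X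
  ℱX X Y 𝒞′ = Σ (List (Comp X)) λ L →
    ∀ C → 𝒞 X Y C → ¬ Any (C ≈C_) L → proj₁ 𝒞′ C

  Principal : (X : FinSet) → Filt X → Set₁
  Principal X F = Σ (Comp X) λ C → F ≐ cX X C

  In𝔉 : (X : FinSet) → Filt X → Set₁
  In𝔉 X F = Principal X F ⊎ Σ FinSet λ Y → Crit X Y × (F ≐ ℱX X Y)

  φ : ∀ {X X'} → X ⊆ X' → Comp X' → Comp X
  φ s (comp r r∉) = comp r (λ r∈ → r∉ (s r∈))

  𝔣Rel : (X X' : FinSet) → X ⊆ X' → Filt X' → Filt X → Set₁
  𝔣Rel X X' s F' F =
    (∀ (C' : Comp X') → F' ≐ cX X' C' → F ≐ cX X (φ s C'))
    × (∀ (Y : FinSet) → Crit X' Y → F' ≐ ℱX X' Y →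
         ((Y ⊆ X) → F ≐ ℱX X Y)
         × (¬ (Y ⊆ X) → Σ (Comp X) λ C →
              (∀ (C' : Comp X') → 𝒞 X' Y C' → ∀ v → v ∈C C' → v ∈C C)
              × (F ≐ cX X C)))

  record Pt : Set₁ where
    field
      F : (X : FinSet) → Filt X
      inF : ∀ X → In𝔉 X (F X)
      compat : ∀ X X' (s : X ⊆ X') → 𝔣Rel X X' s (F X') (F X)

  open Pt public

  InΩ : Pt → Set₁
  InΩ 𝔳 = ∀ X → Principal X (F 𝔳 X)

  𝒳 : Pt → FinSet → Set₁
  𝒳 𝔳 X = ¬ Principal X (F 𝔳 X)

  IsLeast : Pt → FinSet → Set₁
  IsLeast 𝔳 X₀ = 𝒳 𝔳 X₀ × (∀ X → 𝒳 𝔳 X → X₀ ⊆ X)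

  _≈P_ : Pt → Pt → Set₁
  𝔳 ≈P 𝔴 = ∀ X → F 𝔳 X ≐ F 𝔴 X

module Submission where

-- Propagation: if 𝔳_X = ℱ_X(Y) with Y ∈ crit(X), compatibility along
-- X ⊆ X ∪ Z forces 𝔳_{X∪Z} = ℱ_{X∪Z}(Y) (since ℱ_X(Y') = ℱ_X(Y) forces Y' = Y),
-- and then compatibility along Z ⊆ X ∪ Z gives 𝔳_Z = ℱ_Z(Y) when Y ⊆ Z and
-- 𝔳_Z = c_Z(C), C ⊇ ⋃ 𝒞_{Z∪Y}(Y), when Y ⊄ Z.  Hence 𝒳_𝔳 is the set of
-- supersets of Y and Y is its critical least element (part 1).  A least element
-- X₀ anchors 𝔳 at itself, 𝔳_{X₀} = ℱ_{X₀}(X₀), and two points anchored at X₀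
-- agree by propagation (part 2).  For critical Y, "ℱ_X(Y) if Y ⊆ X, else c_X of
-- the component containing Y ∖ X" is a point (part 3): Y ∖ X lies in one
-- component of G − X, linked through a member of 𝒞_Y(Y) avoiding X.

open import Defs
open import Data.Empty using (⊥; ⊥-elim)
open import Data.List using (List; []; _∷_; _++_; map)
open import Data.List.Membership.Propositional using (_∈_; _∉_)
open import Data.List.Membership.Propositional.Properties using (∈-++⁺ˡ; ∈-++⁺ʳ)
open import Data.List.Relation.Unary.Any using (Any; here; there)
import Data.List.Relation.Unary.Any as Any
import Data.List.Relation.Unary.Any.Properties as Anyₚ
open import Data.Product using (Σ; _×_; _,_; proj₁; proj₂)
open import Data.Sum using (_⊎_; inj₁; inj₂)
open import Relation.Binary.PropositionalEquality using (refl)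
open import Relation.Nullary using (¬_)

module _ (lem : LEM) (G : Graph) where
  open Graph G

  Vs : Set
  Vs = FinSet G

  _⊑_ : Vs → Vs → Set
  A ⊑ B = _⊆_ G A B

  Cp : Vs → Set
  Cp X = Comp G X

  _≈_ : ∀ {X} → Cp X → Cp X → Set
  C ≈ D = _≈C_ G C D

  _∈K_ : ∀ {X} → V → Cp X → Set
  v ∈K C = _∈C_ G v C

  _≐ᶠ_ : ∀ {X} → Filt G X → Filt G X → Set₁
  A ≐ᶠ B = _≐_ G A B

  byContra : ∀ {ℓ} {A : Set ℓ} → ¬ ¬ A → A
  byContra {A = A} nna with lem A
  ... | inj₁ a = a
  ... | inj₂ na = ⊥-elim (nna na)

  nonInclusionWitness : ∀ {A B} → ¬ (A ⊑ B) → Σ V λ y → y ∈ A × y ∉ B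
  nonInclusionWitness A⊈B =
    byContra λ none → A⊈B λ {v} v∈A → byContra λ v∉B → none (v , v∈A , v∉B)

  ⊑-refl : ∀ {A} → A ⊑ A
  ⊑-refl a = a

  ⊑-++ˡ : ∀ {A B} → A ⊑ (A ++ B)
  ⊑-++ˡ = ∈-++⁺ˡ

  ⊑-++ʳ : ∀ {A B} → B ⊑ (A ++ B)
  ⊑-++ʳ {A} = ∈-++⁺ʳ A

  SameSet : Vs → Vs → Set
  SameSet A B = (A ⊑ B) × (B ⊑ A)

  sameSet-sym : ∀ {A B} → SameSet A B → SameSet B A
  sameSet-sym (A⊑B , B⊑A) = B⊑A , A⊑B

  start∉ : ∀ {X u v} → Conn G X u v → u ∉ X
  start∉ (Conn.here u∉) = u∉
  start∉ (step u∉ _ _) = u∉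

  end∉ : ∀ {X u v} → Conn G X u v → v ∉ X
  end∉ (Conn.here v∉) = v∉
  end∉ (step _ _ p) = end∉ p

  conn-trans : ∀ {X u w v} → Conn G X u w → Conn G X w v → Conn G X u v
  conn-trans (Conn.here _) q = q
  conn-trans (step u∉ u~ p) q = step u∉ u~ (conn-trans p q)

  conn-sym : ∀ {X u v} → Conn G X u v → Conn G X v u
  conn-sym (Conn.here v∉) = Conn.here v∉
  conn-sym (step u∉ u~w p) =
    conn-trans (conn-sym p) (step (start∉ p) (~-sym u~w) (Conn.here u∉))

  conn-mono : ∀ {X X'} → X ⊑ X' → ∀ {u v} → Conn G X' u v → Conn G X u v
  conn-mono s (Conn.here v∉) = Conn.here (λ v∈ → v∉ (s v∈))
  conn-mono s (step u∉ u~ p) = step (λ u∈ → u∉ (s u∈)) u~ (conn-mono s p)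

  conn-restrict : ∀ {X Y a b} → Conn G Y a b →
                  (∀ w → Conn G Y a w → w ∉ X) → Conn G X a b
  conn-restrict {b = b} (Conn.here b∉) avoid = Conn.here (avoid b (Conn.here b∉))
  conn-restrict {a = a} (step a∉ a~ p) avoid =
    step (avoid a (Conn.here a∉)) a~
         (conn-restrict p (λ w q → avoid w (step a∉ a~ q)))

  ≈-refl : ∀ {X} (C : Cp X) → C ≈ C
  ≈-refl C = Conn.here (rep∉ C)

  ∈K-resp : ∀ {X} {C D : Cp X} → C ≈ D → ∀ {v} → v ∈K C → v ∈K D
  ∈K-resp C≈D v∈C = conn-trans (conn-sym C≈D) v∈C

  nbhd-resp : ∀ {X} {C D : Cp X} → C ≈ D → ∀ {x} → InNbhd G C x → InNbhd G D x
  nbhd-resp {C = C} {D} C≈D (x∉C , v , v∈C , v~x) =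
    (λ x∈D → x∉C (∈K-resp {C = D} {C} (conn-sym C≈D) x∈D))
    , v , ∈K-resp {C = C} {D} C≈D v∈C , v~x

  𝒞-resp-≈ : ∀ {X A} {C D : Cp X} → C ≈ D → 𝒞 G X A C → 𝒞 G X A D
  𝒞-resp-≈ {C = C} {D} C≈D c x =
    (λ n → proj₁ (c x) (nbhd-resp {C = D} {C} (conn-sym C≈D) n))
    , (λ x∈A → nbhd-resp {C = C} {D} C≈D (proj₂ (c x) x∈A))

  𝒞-resp-same : ∀ {X A B} {C : Cp X} → SameSet A B → 𝒞 G X A C → 𝒞 G X B C
  𝒞-resp-same (A⊑B , B⊑A) c x = (λ n → A⊑B (proj₁ (c x) n)) , (λ x∈B → proj₂ (c x) (B⊑A x∈B))

  crit-resp-same : ∀ {X A B} → SameSet A B → Crit G X A → Crit G X B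
  crit-resp-same same (A⊑X , infA) =
    (λ b → A⊑X (proj₂ same b))
    , λ (L , covers) → infA (L , λ C c → covers C (𝒞-resp-same {C = C} same c))

  avoidList : ∀ {X} {P : Cp X → Set} → InfiniteComps G X P → (L : List (Cp X)) →
              Σ (Cp X) λ C → P C × ¬ Any (C ≈_) L
  avoidList inf L =
    byContra λ none → inf (L , λ C pC → byContra λ C∉L → none (C , pC , C∉L))

  ≐-refl : ∀ {X} {A : Filt G X} → A ≐ᶠ A
  ≐-refl _ = (λ a → a) , (λ a → a)

  ≐-sym : ∀ {X} {A B : Filt G X} → A ≐ᶠ B → B ≐ᶠ A
  ≐-sym e 𝒟 = proj₂ (e 𝒟) , proj₁ (e 𝒟)

  ≐-trans : ∀ {X} {A B D : Filt G X} → A ≐ᶠ B → B ≐ᶠ D → A ≐ᶠ D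
  ≐-trans e f 𝒟 = (λ a → proj₁ (f 𝒟) (proj₁ (e 𝒟) a)) , (λ d → proj₂ (e 𝒟) (proj₂ (f 𝒟) d))

  c-resp : ∀ {X} {C D : Cp X} → C ≈ D → cX G X C ≐ᶠ cX G X D
  c-resp C≈D 𝒟 = proj₂ 𝒟 C≈D , proj₂ 𝒟 (conn-sym C≈D)

  -- c_X(C) determines C: test both on the set of components equal to C.
  c-injective : ∀ {X} {C D : Cp X} → cX G X C ≐ᶠ cX G X D → C ≈ D
  c-injective {C = C} e =
    proj₁ (e ((λ E → C ≈ E) , λ E≈E' C≈E → conn-trans C≈E E≈E')) (≈-refl C)

  ℱ-resp-same : ∀ {X A B} → SameSet A B → ℱX G X A ≐ᶠ ℱX G X B
  ℱ-resp-same same _ =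
    (λ (L , h) → L , λ C cB → h C (𝒞-resp-same {C = C} (sameSet-sym same) cB))
    , (λ (L , h) → L , λ C cA → h C (𝒞-resp-same {C = C} same cA))

  -- ℱ_X(A) is never principal: it contains the complement of {C}, c_X(C) does not.
  ℱ-nonprincipal : ∀ {X A} (C : Cp X) → ¬ (ℱX G X A ≐ᶠ cX G X C)
  ℱ-nonprincipal {X} C e =
    proj₁ (e notC) ((C ∷ []) , λ D _ D∉[C] C≈D → D∉[C] (here (conn-sym C≈D))) (≈-refl C)
    where
    notC : SubComp G X
    notC = (λ D → ¬ (C ≈ D)) , λ D≈D' C≉D C≈D' → C≉D (conn-trans C≈D' (conn-sym D≈D'))

  -- If ℱ_X(A) = ℱ_X(B) and 𝒞_X(B) is infinite, so is 𝒞_X(A): the empty set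
  -- lies in ℱ_X(A) exactly when 𝒞_X(A) is finite.
  ℱ-infinite : ∀ {X A B} → ℱX G X A ≐ᶠ ℱX G X B →
               InfiniteComps G X (𝒞 G X B) → InfiniteComps G X (𝒞 G X A)
  ℱ-infinite {X} e infB (L , covers) with proj₁ (e ∅) (L , λ C cA C∉L → C∉L (covers C cA))
    where
    ∅ : SubComp G X
    ∅ = (λ _ → ⊥) , λ _ ()
  ... | L' , h = infB (L' , λ C cB → byContra (h C cB))

  -- ℱ_X(A) = ℱ_X(B) with 𝒞_X(B) infinite forces A = B: 𝒞_X(A) ∈ ℱ_X(B), so
  -- some member of 𝒞_X(B) also lies in 𝒞_X(A).
  ℱ-anchor-unique : ∀ {X A B} → ℱX G X A ≐ᶠ ℱX G X B →
                    InfiniteComps G X (𝒞 G X B) → SameSet A B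
  ℱ-anchor-unique {X} {A} e infB
    with proj₁ (e ((𝒞 G X A) , λ {C} {D} → 𝒞-resp-≈ {C = C} {D})) ([] , λ _ cA _ → cA)
  ... | L , h with avoidList infB L
  ... | C , cB , C∉L =
    (λ {x} x∈A → proj₁ (cB x) (proj₂ (h C cB C∉L x) x∈A))
    , (λ {x} x∈B → proj₁ (h C cB C∉L x) (proj₂ (cB x) x∈B))

  -- Propagation: one non-principal coordinate ℱ_X(Y) determines 𝔳

  module Propagation (𝔳 : Pt G) (X Y : Vs) (crit : Crit G X Y)
                     (𝔳X : F 𝔳 X ≐ᶠ ℱX G X Y) where

    nonPrincipalAtX : ¬ Principal G X (F 𝔳 X)
    nonPrincipalAtX (C , e) = ℱ-nonprincipal C (≐-trans (≐-sym 𝔳X) e)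

    -- At every finite superset X ∪ Z the coordinate is again ℱ(Y): any other
    -- value of 𝔳_{X∪Z} would be mapped to a principal filter or to ℱ_X(Y') ≠ ℱ_X(Y).
    atExtension : ∀ Z → Crit G (X ++ Z) Y × (F 𝔳 (X ++ Z) ≐ᶠ ℱX G (X ++ Z) Y)
    atExtension Z with inF 𝔳 (X ++ Z)
    ... | inj₁ (C' , e') =
      ⊥-elim (nonPrincipalAtX (_ , proj₁ (compat 𝔳 X (X ++ Z) ⊑-++ˡ) C' e'))
    ... | inj₂ (Y' , crit' , e') with lem (Y' ⊑ X)
    ...   | inj₂ Y'⊈X =
      let (C , _ , e) = proj₂ (proj₂ (compat 𝔳 X (X ++ Z) ⊑-++ˡ) Y' crit' e') Y'⊈X
      in ⊥-elim (nonPrincipalAtX (C , e))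
    ...   | inj₁ Y'⊑X = crit-resp-same same crit' , ≐-trans e' (ℱ-resp-same same)
      where
      downstairs : F 𝔳 X ≐ᶠ ℱX G X Y'
      downstairs = proj₁ (proj₂ (compat 𝔳 X (X ++ Z) ⊑-++ˡ) Y' crit' e') Y'⊑X
      same : SameSet Y' Y
      same = ℱ-anchor-unique (≐-trans (≐-sym downstairs) 𝔳X) (proj₂ crit)

    -- Above Y the coordinate is ℱ(Y), by projecting from X ∪ Z.
    atSuperset : ∀ Z → Y ⊑ Z → F 𝔳 Z ≐ᶠ ℱX G Z Y
    atSuperset Z Y⊑Z =
      let (crit' , e') = atExtension Z
      in proj₁ (proj₂ (compat 𝔳 Z (X ++ Z) ⊑-++ʳ) Y crit' e') Y⊑Z

    critAt : ∀ Z → Y ⊑ Z → Crit G Z Y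
    critAt Z Y⊑Z with inF 𝔳 Z
    ... | inj₁ (C , e) = ⊥-elim (ℱ-nonprincipal C (≐-trans (≐-sym (atSuperset Z Y⊑Z)) e))
    ... | inj₂ (_ , crit' , e') =
      Y⊑Z , ℱ-infinite (≐-trans (≐-sym (atSuperset Z Y⊑Z)) e') (proj₂ crit')

    notAbove : ∀ Z W → Z ⊑ W → Y ⊑ W → ¬ (Y ⊑ Z) →
               Σ (Cp Z) λ C → (∀ (C' : Cp W) → 𝒞 G W Y C' → ∀ v → v ∈K C' → v ∈K C)
                              × (F 𝔳 Z ≐ᶠ cX G Z C)
    notAbove Z W Z⊑W Y⊑W =
      proj₂ (proj₂ (compat 𝔳 Z W Z⊑W) Y (critAt W Y⊑W) (atSuperset W Y⊑W))

    𝒳⇒above : ∀ Z → 𝒳 G 𝔳 Z → Y ⊑ Z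
    𝒳⇒above Z Z∈𝒳 = byContra λ Y⊈Z →
      let (C , _ , e) = notAbove Z (Z ++ Y) ⊑-++ˡ ⊑-++ʳ Y⊈Z in Z∈𝒳 (C , e)

    above⇒𝒳 : ∀ Z → Y ⊑ Z → 𝒳 G 𝔳 Z
    above⇒𝒳 Z Y⊑Z (C , e) = ℱ-nonprincipal C (≐-trans (≐-sym (atSuperset Z Y⊑Z)) e)

    least : IsLeast G 𝔳 Y
    least = above⇒𝒳 Y ⊑-refl , 𝒳⇒above

  nonEndAnchor : ∀ (𝔳 : Pt G) → ¬ InΩ G 𝔳 →
                 Σ Vs λ X → Σ Vs λ Y → Crit G X Y × (F 𝔳 X ≐ᶠ ℱX G X Y)
  nonEndAnchor 𝔳 notEnd
    with byContra {A = Σ Vs λ X → ¬ Principal G X (F 𝔳 X)}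
                  (λ none → notEnd λ X → byContra λ np → none (X , np))
  ... | X , np with inF 𝔳 X
  ...   | inj₁ p = ⊥-elim (np p)
  ...   | inj₂ (Y , crit , e) = X , Y , crit , e

  leastAnchors : ∀ (𝔳 : Pt G) X₀ → IsLeast G 𝔳 X₀ →
                 Crit G X₀ X₀ × (F 𝔳 X₀ ≐ᶠ ℱX G X₀ X₀)
  leastAnchors 𝔳 X₀ (X₀∈𝒳 , minimal) with inF 𝔳 X₀
  ... | inj₁ p = ⊥-elim (X₀∈𝒳 p)
  ... | inj₂ (Y , crit , e) = crit-resp-same same crit , ≐-trans e (ℱ-resp-same same)
    where
    module P = Propagation 𝔳 X₀ Y crit e
    same : SameSet Y X₀
    same = P.𝒳⇒above X₀ X₀∈𝒳 , minimal Y (P.above⇒𝒳 Y ⊑-refl)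

  anchoredAgree : ∀ (𝔳 𝔴 : Pt G) X₀ → Crit G X₀ X₀ →
                  F 𝔳 X₀ ≐ᶠ ℱX G X₀ X₀ → F 𝔴 X₀ ≐ᶠ ℱX G X₀ X₀ → _≈P_ G 𝔳 𝔴
  anchoredAgree 𝔳 𝔴 X₀ crit e𝔳 e𝔴 Z = agree (lem (X₀ ⊑ Z))
    where
    module V = Propagation 𝔳 X₀ X₀ crit e𝔳
    module W = Propagation 𝔴 X₀ X₀ crit e𝔴

    -- Below X₀ both coordinates are principal at components of G − Z that
    -- contain a common member K of 𝒞_{Z∪X₀}(X₀).
    agreeBelow : ¬ (X₀ ⊑ Z) → F 𝔳 Z ≐ᶠ F 𝔴 Z
    agreeBelow X₀⊈Z
      with V.notAbove Z (Z ++ X₀) ⊑-++ˡ ⊑-++ʳ X₀⊈Z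
         | W.notAbove Z (Z ++ X₀) ⊑-++ˡ ⊑-++ʳ X₀⊈Z
         | avoidList (proj₂ (V.critAt (Z ++ X₀) ⊑-++ʳ)) []
    ... | C , C⊇ , eC | D , D⊇ , eD | K , K∈𝒞 , _ =
      ≐-trans eC (≐-trans (c-resp C≈D) (≐-sym eD))
      where
      C≈D : C ≈ D
      C≈D = conn-trans (C⊇ K K∈𝒞 (rep K) (≈-refl K)) (conn-sym (D⊇ K K∈𝒞 (rep K) (≈-refl K)))

    agree : (X₀ ⊑ Z) ⊎ ¬ (X₀ ⊑ Z) → F 𝔳 Z ≐ᶠ F 𝔴 Z
    agree (inj₁ X₀⊑Z) = ≐-trans (V.atSuperset Z X₀⊑Z) (≐-sym (W.atSuperset Z X₀⊑Z))
    agree (inj₂ X₀⊈Z) = agreeBelow X₀⊈Z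

  structureOfNonEnds : ∀ (𝔳 : Pt G) → ¬ InΩ G 𝔳 →
      Σ (FinSet G) λ X₀ → IsLeast G 𝔳 X₀ × Critical G X₀
        × (∀ X → 𝒳 G 𝔳 X ↔ _⊆_ G X₀ X)
        × (∀ X → 𝒳 G 𝔳 X → _≐_ G (F 𝔳 X) (ℱX G X X₀))
  structureOfNonEnds 𝔳 notEnd with nonEndAnchor 𝔳 notEnd
  ... | X , Y , crit , e =
    Y , P.least , P.critAt Y ⊑-refl
    , (λ Z → P.𝒳⇒above Z , P.above⇒𝒳 Z)
    , (λ Z Z∈𝒳 → P.atSuperset Z (P.𝒳⇒above Z Z∈𝒳))
    where module P = Propagation 𝔳 X Y crit e

  leastDetermines : ∀ (𝔳 𝔴 : Pt G) (X₀ : FinSet G) →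
                    IsLeast G 𝔳 X₀ → IsLeast G 𝔴 X₀ → _≈P_ G 𝔳 𝔴
  leastDetermines 𝔳 𝔴 X₀ least𝔳 least𝔴 =
    anchoredAgree 𝔳 𝔴 X₀ (proj₁ anchor𝔳) (proj₂ anchor𝔳) (proj₂ (leastAnchors 𝔴 X₀ least𝔴))
    where
    anchor𝔳 : Crit G X₀ X₀ × (F 𝔳 X₀ ≐ᶠ ℱX G X₀ X₀)
    anchor𝔳 = leastAnchors 𝔳 X₀ least𝔳

  -- Construction of the point anchored at a critical set Y

  module Construction (Y : Vs) (critY : Critical G Y) where

    Side : Vs → Set
    Side X = (Y ⊑ X) ⊎ Σ V λ y → y ∈ Y × y ∉ X

    side : ∀ X → Side X
    side X with lem (Y ⊑ X)
    ... | inj₁ Y⊑X = inj₁ Y⊑X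
    ... | inj₂ Y⊈X = inj₂ (nonInclusionWitness Y⊈X)

    coord : ∀ {X} → Side X → Filt G X
    coord {X} (inj₁ _) = ℱX G X Y
    coord {X} (inj₂ (y , _ , y∉X)) = cX G X (comp y y∉X)

    compsMeeting : Vs → List (Cp Y)
    compsMeeting [] = []
    compsMeeting (z ∷ Z) with lem (z ∈ Y)
    ... | inj₁ _ = compsMeeting Z
    ... | inj₂ z∉Y = comp z z∉Y ∷ compsMeeting Z

    compsMeeting-complete : ∀ Z {z} (K : Cp Y) → z ∈ Z → z ∉ Y → z ∈K K →
                            Any (K ≈_) (compsMeeting Z)
    compsMeeting-complete (z ∷ Z) K (here refl) z∉Y z∈K with lem (z ∈ Y)
    ... | inj₁ z∈Y = ⊥-elim (z∉Y z∈Y)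
    ... | inj₂ _ = here z∈K
    compsMeeting-complete (z ∷ Z) K (there w∈Z) w∉Y w∈K with lem (z ∈ Y)
    ... | inj₁ _ = compsMeeting-complete Z K w∈Z w∉Y w∈K
    ... | inj₂ _ = there (compsMeeting-complete Z K w∈Z w∉Y w∈K)

    -- Infinitely many members of 𝒞_Y(Y) exist, so one avoids both a given
    -- finite list of components and a given finite vertex set Z.
    freshComponent : ∀ Z (L : List (Cp Y)) →
                     Σ (Cp Y) λ K → 𝒞 G Y Y K × ¬ Any (K ≈_) L × (∀ w → w ∈K K → w ∉ Z)
    freshComponent Z L with avoidList (proj₂ critY) (L ++ compsMeeting Z)
    ... | K , K∈𝒞 , fresh =
      K , K∈𝒞 , (λ K∈L → fresh (Anyₚ.++⁺ˡ K∈L))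
      , λ w w∈K w∈Z → fresh (Anyₚ.++⁺ʳ L (compsMeeting-complete Z K w∈Z (end∉ w∈K) w∈K))

    -- The vertices of Y outside Z all lie in one component of G − Z: both
    -- are neighbours of a member of 𝒞_Y(Y) that avoids Z.
    linkedOutside : ∀ {Z y y'} → y ∈ Y → y' ∈ Y → y ∉ Z → y' ∉ Z → Conn G Z y y'
    linkedOutside {Z} y∈Y y'∈Y y∉Z y'∉Z with freshComponent Z []
    ... | K , K∈𝒞 , _ , avoidZ with proj₂ (K∈𝒞 _) y∈Y | proj₂ (K∈𝒞 _) y'∈Y
    ... | (_ , u , u∈K , u~y) | (_ , u' , u'∈K , u'~y') =
      step y∉Z (~-sym u~y)
        (conn-trans (conn-sym (conn-restrict u∈K avoidZ))
          (conn-trans (conn-restrict u'∈K avoidZ)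
            (step (avoidZ u' u'∈K) u'~y' (Conn.here y'∉Z))))

    -- Y ∈ crit(X) for every X ⊇ Y: a member of 𝒞_Y(Y) avoiding X is also a
    -- component of G − X with neighbourhood Y.
    criticalAbove : ∀ X → Y ⊑ X → InfiniteComps G X (𝒞 G X Y)
    criticalAbove X Y⊑X (L , covers) with freshComponent X (map (φ G Y⊑X) L)
    ... | K , K∈𝒞 , fresh , avoidX =
      fresh (Anyₚ.map⁺ (Any.map (conn-mono Y⊑X) (covers K' K'∈𝒞)))
      where
      K' : Cp X
      K' = comp (rep K) (avoidX (rep K) (≈-refl K))
      K'∈𝒞 : 𝒞 G X Y K'
      K'∈𝒞 x =
        (λ (x∉K' , v , v∈K' , v~x) →
           proj₁ (K∈𝒞 x) ((λ x∈K → x∉K' (conn-restrict x∈K avoidX)) , v , conn-mono Y⊑X v∈K' , v~x))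
        , (λ x∈Y → let (x∉K , v , v∈K , v~x) = proj₂ (K∈𝒞 x) x∈Y
                   in (λ x∈K' → x∉K (conn-mono Y⊑X x∈K')) , v , conn-restrict v∈K avoidX , v~x)

    coord∈𝔉 : ∀ {X} (d : Side X) → In𝔉 G X (coord d)
    coord∈𝔉 {X} (inj₁ Y⊑X) = inj₂ (Y , (Y⊑X , criticalAbove X Y⊑X) , ≐-refl)
    coord∈𝔉 (inj₂ (y , _ , y∉X)) = inj₁ (comp y y∉X , ≐-refl)

    compatible : ∀ X X' (s : X ⊑ X') (d : Side X) (d' : Side X') →
                 𝔣Rel G X X' s (coord d') (coord d)
    compatible X X' s (inj₁ Y⊑X) (inj₂ (y' , y'∈Y , y'∉X')) = ⊥-elim (y'∉X' (s (Y⊑X y'∈Y)))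
    compatible X X' s (inj₂ (y , y∈Y , y∉X)) (inj₂ (y' , y'∈Y , y'∉X')) =
      (λ C' e → c-resp (conn-trans (linkedOutside y∈Y y'∈Y y∉X (λ y'∈X → y'∉X' (s y'∈X)))
                                   (conn-mono s (c-injective e))))
      , λ _ _ e → ⊥-elim (ℱ-nonprincipal _ (≐-sym e))
    compatible X X' s (inj₁ Y⊑X) (inj₁ _) =
      (λ C' e → ⊥-elim (ℱ-nonprincipal C' e))
      , λ Y' crit' e → let same = ℱ-anchor-unique e (proj₂ crit') in
          (λ _ → ℱ-resp-same same) , (λ Y'⊈X → ⊥-elim (Y'⊈X (λ y → Y⊑X (proj₂ same y))))
    compatible X X' s (inj₂ (y , y∈Y , y∉X)) (inj₁ _) =
      (λ C' e → ⊥-elim (ℱ-nonprincipal C' e))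
      , λ Y' crit' e → let same = ℱ-anchor-unique e (proj₂ crit') in
          (λ Y'⊑X → ⊥-elim (y∉X (Y'⊑X (proj₁ same y∈Y))))
          , (λ _ → comp y y∉X , contains same , ≐-refl)
      where
      -- every member of 𝒞_{X'}(Y') has y as a neighbour, so lies in the
      -- component of G − X containing y
      contains : ∀ {Y'} → SameSet Y Y' → ∀ (C' : Cp X') → 𝒞 G X' Y' C' →
                 ∀ v → v ∈K C' → v ∈K comp {G} {X} y y∉X
      contains same C' C'∈𝒞 v v∈C' =
        let (_ , u , u∈C' , u~y) = proj₂ (C'∈𝒞 y) (proj₁ same y∈Y)
        in step y∉X (~-sym u~y) (conn-mono s (conn-trans (conn-sym u∈C') v∈C'))

    point : Pt G
    point = record { F = λ X → coord (side X)
                   ; inF = λ X → coord∈𝔉 (side X)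
                   ; compat = λ X X' s → compatible X X' s (side X) (side X') }

    pointLeast : IsLeast G point Y
    pointLeast = atY (side Y) , λ Z → aboveY Z (side Z)
      where
      atY : (d : Side Y) → ¬ Principal G Y (coord d)
      atY (inj₁ _) (C , e) = ℱ-nonprincipal C e
      atY (inj₂ (_ , y∈Y , y∉Y)) _ = y∉Y y∈Y
      aboveY : ∀ Z (d : Side Z) → ¬ Principal G Z (coord d) → Y ⊑ Z
      aboveY Z (inj₁ Y⊑Z) _ = Y⊑Z
      aboveY Z (inj₂ (y , _ , y∉Z)) np = ⊥-elim (np (comp y y∉Z , ≐-refl))

  realisation : ∀ (Y : FinSet G) → Critical G Y →
      Σ (Pt G) λ 𝔳 → IsLeast G 𝔳 Y × (∀ (𝔴 : Pt G) → IsLeast G 𝔴 Y → _≈P_ G 𝔴 𝔳)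
  realisation Y critY =
    point , pointLeast , λ 𝔴 least𝔴 → leastDetermines 𝔴 point Y least𝔴 pointLeast
    where open Construction Y critY

proposition5p3p8 : LEM → (G : Graph) →
    (∀ (𝔳 : Pt G) → ¬ InΩ G 𝔳 →
      Σ (FinSet G) λ X₀ → IsLeast G 𝔳 X₀ × Critical G X₀
        × (∀ X → 𝒳 G 𝔳 X ↔ _⊆_ G X₀ X)
        × (∀ X → 𝒳 G 𝔳 X → _≐_ G (F 𝔳 X) (ℱX G X X₀)))
    × (∀ (𝔳 𝔴 : Pt G) (X₀ : FinSet G) → IsLeast G 𝔳 X₀ → IsLeast G 𝔴 X₀ → _≈P_ G 𝔳 𝔴)
    × (∀ (Y : FinSet G) → Critical G Y →
      Σ (Pt G) λ 𝔳 → IsLeast G 𝔳 Y × (∀ (𝔴 : Pt G) → IsLeast G 𝔴 Y → _≈P_ G 𝔴 𝔳))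
proposition5p3p8 lem G =
  structureOfNonEnds lem G , leastDetermines lem G , realisation lem G
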